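{- For $n\ge 1$, let $K_n=\kappa_{n+1}/(n+1)$, where $\kappa_{n+1}$ is the number of kernel positions of rank $n+1$ in the flat Bernoulli game. Then $K_n$ is the number of permutations $\pi\in S_n$ for which there exist indices $0=i_0<i_1<\cdots<i_{k+1}=n$ (for some $k\ge0$) such that for each $j\in\{0,\ldots,k\}$ we have $\pi(i_{j+1})<\pi(i_j+1)<\pi(l)$ for all $l$ with $i_j+1<l<i_{j+1}$.
   Context: The flat Bernoulli game: positions are words $u_1\cdots u_n$ ($n\ge0$) of positive integers with $1\le u_i\le i$; a valid move replaces $u_1\cdots u_n$ by $u_1\cdots u_m$ for some $1\le m<n$ such that $u_{m+1}<u_j$ for all $j>m+1$. Players alternate; a player unable to move loses; kernel positions are positions of Grundy number zero (every valid move from them leads to a non-kernel position). -}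

module Defs where

open import Data.Nat using (ℕ; zero; suc; _+_; _*_; _≤_; _<_)
open import Data.List using (List; []; _∷_; length; take; map; upTo)
open import Data.List.Membership.Propositional using (_∈_)
open import Data.List.Relation.Unary.Unique.Propositional using (Unique)
open import Data.List.Relation.Binary.Permutation.Propositional using (_↭_)
open import Data.Product using (Σ; ∃; _×_)
open import Function.Bundles using (_⇔_)
open import Relation.Binary.PropositionalEquality using (_≡_)

-- 1-based access: w ! i = u_i for 1 ≤ i ≤ length w (0 outside that range).
_!_ : List ℕ → ℕ → ℕ
[]       ! _             = 0
(x ∷ xs) ! zero          = 0
(x ∷ xs) ! suc zero      = x
(x ∷ xs) ! suc (suc i)   = xs ! suc i

IsPosition : List ℕ → Set
IsPosition w = ∀ i → 1 ≤ i → i ≤ length w → (1 ≤ w ! i) × (w ! i ≤ i)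

-- A valid move u_1⋯u_n ↦ u_1⋯u_m : 1 ≤ m < n and u_{m+1} < u_j for all j > m+1.
ValidMove : List ℕ → ℕ → Set
ValidMove w m =
  (1 ≤ m) × (m < length w) ×
  (∀ j → suc m < j → j ≤ length w → w ! suc m < w ! j)

-- Kernel positions (Grundy number zero): every valid move leads to a
-- non-kernel position; non-kernel: some valid move leads to a kernel position.
-- (Well-founded since moves strictly shorten the word.)
data Kernel (w : List ℕ) : Set
data NonKernel (w : List ℕ) : Set

data Kernel w where
  kernel : (∀ m → ValidMove w m → NonKernel (take m w)) → Kernel w

data NonKernel w where
  nonkernel : ∀ m → ValidMove w m → Kernel (take m w) → NonKernel w

KernelPosition : ℕ → List ℕ → Set
KernelPosition r w = (length w ≡ r) × IsPosition w × Kernel w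

-- π ∈ S_n, represented as the list [π(1), …, π(n)]
IsPerm : ℕ → List ℕ → Set
IsPerm n π = π ↭ map suc (upTo n)

BlockCondition : ℕ → List ℕ → Set
BlockCondition n π =
  Σ ℕ λ k → Σ (ℕ → ℕ) λ i →
    (i 0 ≡ 0) × (i (suc k) ≡ n) × (∀ j → j ≤ k → i j < i (suc j)) ×
    (∀ j → j ≤ k →
       (π ! i (suc j) < π ! (i j + 1)) ×
       (∀ l → i j + 1 < l → l < i (suc j) → π ! (i j + 1) < π ! l))

HasCount : (List ℕ → Set) → ℕ → Set
HasCount P c = Σ (List (List ℕ)) λ L →
  Unique L × (∀ x → (x ∈ L) ⇔ P x) × (length L ≡ c)

module Submission where

-- The argument has four parts.
--   * Segments: for a decidable relation R, a chain is a word whose tail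
--     splits greedily into segments, each ending at the first letter
--     R-related to the segment's head.
--   * A position u ∷ v is a kernel position iff v is a chain for z ≤ x
--     (kernel⇔chain); a nonempty list of distinct letters satisfies the
--     block condition iff it is a chain for z < x (blockCondition⇔chain).
--   * The code (inversion table) cᵢ = 1 + #{j < i : τⱼ ≤ τᵢ} is a bijection
--     from permutations of 1, …, N onto positions of rank N, and it turns
--     chains for z < x into chains for z ≤ x (chain⇔code-chain).
--   * A permutation of 1, …, n+1 is c ∷ bump_c π with c ≤ n+1 and π ∈ S_n;
--     its code is a kernel position iff π satisfies the block condition.
--     Listing these codes over all c and π gives the count.

open import Defs
open import Data.Nat using (ℕ; zero; suc; pred; _+_; _*_; _≤_; _<_; z≤n; s≤s; _≤?_; _<?_)
open import Data.Nat.Properties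
open import Data.Nat.Induction using (<-wellFounded)
open import Data.Product using (Σ; ∃; _×_; _,_; proj₁; proj₂)
open import Data.Sum using (_⊎_; inj₁; inj₂)
open import Data.Empty using (⊥; ⊥-elim)
open import Data.List
  using (List; []; _∷_; length; take; drop; map; upTo; _++_; _∷ʳ_; _ʳ++_; filter; cartesianProduct)
open import Data.List.Properties
  using (++-assoc; ++-identityʳ; ∷-injective; ∷ʳ-injective; ʳ++-defn; length-++; length-map;
         map-++; map-∘; map-cong; map-id; map-id-local; map-injective; upTo-∷ʳ; length-upTo;
         drop-all; filter-accept; filter-reject; filter-++; length-filter; filter-all; filter-none)
open import Data.List.Reverse using (Reverse; []; _∶_∶ʳ_; reverseView)
open import Data.List.Relation.Unary.All as All using (All; []; _∷_)
import Data.List.Relation.Unary.All.Properties as AllP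
open import Data.List.Relation.Unary.Any using (here; there)
open import Data.List.Relation.Unary.AllPairs using ([]; _∷_)
open import Data.List.Relation.Unary.Unique.Propositional using (Unique)
import Data.List.Relation.Unary.Unique.Propositional.Properties as UP
open import Data.List.Membership.Propositional using (_∈_)
open import Data.List.Membership.Propositional.Properties
  using (∈-map⁺; ∈-map⁻; ∈-upTo⁺; ∈-upTo⁻; ∈-cartesianProduct⁺; ∈-cartesianProduct⁻; ∈-++⁺ʳ;
         ∈-filter⁺; ∈-filter⁻)
open import Data.List.Relation.Binary.Permutation.Propositional
  using (_↭_; ↭-refl; ↭-sym; ↭-trans; ↭-reflexive; prep; ↭⇒↭ₛ; module PermutationReasoning)
open import Data.List.Relation.Binary.Permutation.Propositional.Properties
  using (↭-length; filter-↭; ↭-reverse; ∷↭∷ʳ; ++⁺ʳ; map⁺; drop-∷; ∈-resp-↭; ↭-empty-inv; ¬x∷xs↭[])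
open import Function.Base using (_∘_)
open import Function.Bundles using (_⇔_; mk⇔; Equivalence)
open import Function.Properties.Equivalence using (⇔-setoid)
open import Induction.WellFounded using (Acc; acc)
open import Level using (0ℓ)
open import Relation.Nullary using (¬_; Dec; yes; no)
open import Relation.Binary.Definitions using (tri<; tri≈; tri>)
open import Relation.Binary.PropositionalEquality
import Relation.Binary.Reasoning.Setoid
import Data.List.Relation.Binary.Permutation.Setoid.Properties (setoid ℕ) as SetoidPerm

module ⇔-Reasoning = Relation.Binary.Reasoning.Setoid (⇔-setoid 0ℓ)

module Segments (R : ℕ → ℕ → Set) (R? : ∀ x z → Dec (R x z)) where

  data Segment (x : ℕ) : List ℕ → List ℕ → Set where
    stop : ∀ {z r} → R x z → Segment x (z ∷ r) r
    skip : ∀ {y t r} → ¬ R x y → Segment x t r → Segment x (y ∷ t) r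

  data Chain : List ℕ → Set where
    nil  : Chain []
    cons : ∀ {x t r} → Segment x t r → Chain r → Chain (x ∷ t)

  Blocked : ℕ → List ℕ → Set
  Blocked x t = All (λ y → ¬ R x y) t

  segment? : ∀ x t → (∃ λ r → Segment x t r) ⊎ Blocked x t
  segment? x [] = inj₂ []
  segment? x (y ∷ t) with R? x y | segment? x t
  ... | yes xy | _             = inj₁ (t , stop xy)
  ... | no ¬xy | inj₁ (r , s)  = inj₁ (r , skip ¬xy s)
  ... | no ¬xy | inj₂ blocked  = inj₂ (¬xy ∷ blocked)

  -- The segment for x is the shortest one, hence unique.
  segment-deterministic : ∀ {x t r r′} → Segment x t r → Segment x t r′ → r ≡ r′
  segment-deterministic (stop _)    (stop _)     = refl
  segment-deterministic (stop xz)   (skip ¬xz _) = ⊥-elim (¬xz xz)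
  segment-deterministic (skip ¬xz _) (stop xz)   = ⊥-elim (¬xz xz)
  segment-deterministic (skip _ s)  (skip _ s′)  = segment-deterministic s s′

  -- A segment only looks at a prefix, so anything may be appended.
  segment-++ : ∀ {x t r} q → Segment x t r → Segment x (t ++ q) (r ++ q)
  segment-++ q (stop xz)    = stop xz
  segment-++ q (skip ¬xy s) = skip ¬xy (segment-++ q s)

  -- Segments are nonempty, which makes the greedy decomposition terminate.
  segment-shorter : ∀ {x t r} → Segment x t r → length r < length t
  segment-shorter (stop _)   = ≤-refl
  segment-shorter (skip _ s) = m≤n⇒m≤1+n (segment-shorter s)

  segment⇒split : ∀ {x t r} → Segment x t r →
    Σ (List ℕ) λ ys → Σ ℕ λ z → (t ≡ ys ++ z ∷ r) × Blocked x ys × R x z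
  segment⇒split (stop {z} xz) = [] , z , refl , [] , xz
  segment⇒split (skip {y} ¬xy s) with segment⇒split s
  ... | ys , z , refl , blocked , xz = y ∷ ys , z , refl , ¬xy ∷ blocked , xz

  split⇒segment : ∀ {x ys z} r → Blocked x ys → R x z → Segment x (ys ++ z ∷ r) r
  split⇒segment r []              xz = stop xz
  split⇒segment r (¬xy ∷ blocked) xz = skip ¬xy (split⇒segment r blocked xz)

  unique-after-segment : ∀ {x t r} → Segment x t r → Unique t → Unique r
  unique-after-segment (stop _)   (_ ∷ u) = u
  unique-after-segment (skip _ s) (_ ∷ u) = unique-after-segment s u

  blocked⇒no-segment : ∀ {x t r} → Blocked x t → ¬ Segment x t r
  blocked⇒no-segment (¬xz ∷ _)  (stop xz)   = ¬xz xz
  blocked⇒no-segment (_ ∷ rest) (skip _ s) = blocked⇒no-segment rest s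

  -- Chain decompositions are unique, so a chain prefix of a chain leaves a chain.
  chain-suffix : ∀ {p} q → Chain p → Chain (p ++ q) → Chain q
  chain-suffix q nil c = c
  chain-suffix q (cons s c) (cons s′ c′) with segment-deterministic (segment-++ q s) s′
  ... | refl = chain-suffix q c c′

  -- The place where the greedy chain decomposition of v gets stuck.
  Obstruction : List ℕ → Set
  Obstruction v = Σ (List ℕ) λ p → Σ ℕ λ x → Σ (List ℕ) λ rest →
    (v ≡ p ++ x ∷ rest) × Chain p × Blocked x rest

  chain-or-obstruction : ∀ v → Chain v ⊎ Obstruction v
  chain-or-obstruction v = go v (<-wellFounded (length v))
    where
      go : ∀ v → Acc _<_ (length v) → Chain v ⊎ Obstruction v
      go [] _ = inj₁ nil
      go (x ∷ t) (acc smaller) with segment? x t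
      ... | inj₂ blocked = inj₂ ([] , x , t , refl , nil , blocked)
      ... | inj₁ (r , s) with go r (smaller (m<n⇒m<1+n (segment-shorter s)))
      ...   | inj₁ c = inj₁ (cons s c)
      ...   | inj₂ (p , y , rest , refl , cp , blocked) with segment⇒split s
      ...     | ys , z , refl , blocked′ , xz =
                inj₂ (x ∷ ys ++ z ∷ p , y , rest , cong (x ∷_) (sym (++-assoc ys (z ∷ p) (y ∷ rest))) ,
                      cons (split⇒segment p blocked′ xz) cp , blocked)

  obstruction⇒¬chain : ∀ {v} → Obstruction v → ¬ Chain v
  obstruction⇒¬chain (p , x , rest , refl , cp , blocked) c with chain-suffix (x ∷ rest) cp c
  ... | cons s _ = blocked⇒no-segment blocked s

  chain? : ∀ v → Dec (Chain v)
  chain? v with chain-or-obstruction v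
  ... | inj₁ c  = yes c
  ... | inj₂ ob = no (obstruction⇒¬chain ob)

!-middle : ∀ p (x : ℕ) r → (p ++ x ∷ r) ! suc (length p) ≡ x
!-middle []          x r = refl
!-middle (a ∷ [])    x r = refl
!-middle (a ∷ b ∷ p) x r = !-middle (b ∷ p) x r

!-∷ : ∀ a l k → 1 ≤ k → (a ∷ l) ! suc k ≡ l ! k
!-∷ a l (suc k) _ = refl

!-++ : ∀ p q j → 1 ≤ j → (p ++ q) ! (length p + j) ≡ q ! j
!-++ []      q j 1≤j = refl
!-++ (a ∷ p) q j 1≤j = trans (!-∷ a (p ++ q) (length p + j) (≤-trans 1≤j (m≤n+m j (length p)))) (!-++ p q j 1≤j)

!-++ˡ : ∀ p q i → 1 ≤ i → i ≤ length p → (p ++ q) ! i ≡ p ! i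
!-++ˡ (a ∷ p) q (suc zero)    _ _         = refl
!-++ˡ (a ∷ p) q (suc (suc i)) _ (s≤s i≤p) = !-++ˡ p q (suc i) (s≤s z≤n) i≤p

split-at : ∀ (v : List ℕ) k → k < length v →
  Σ (List ℕ) λ p → Σ ℕ λ x → Σ (List ℕ) λ rest → (v ≡ p ++ x ∷ rest) × (length p ≡ k)
split-at (x ∷ v) zero    _         = [] , x , v , refl , refl
split-at (y ∷ v) (suc k) (s≤s k<v) with split-at v k k<v
... | p , x , rest , refl , refl = y ∷ p , x , rest , refl , refl

length-< : ∀ (p : List ℕ) x rest → length p < length (p ++ x ∷ rest)
length-< []      x rest = s≤s z≤n
length-< (_ ∷ p) x rest = s≤s (length-< p x rest)

take-length-++ : ∀ (p q : List ℕ) → take (length p) (p ++ q) ≡ p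
take-length-++ []      q = refl
take-length-++ (a ∷ p) q = cong (a ∷_) (take-length-++ p q)

Between : List ℕ → ℕ → ℕ → (ℕ → Set) → Set
Between w i j P = ∀ l → i < l → l < j → P (w ! l)

between-∷ : ∀ {a w i j} P → Between (a ∷ w) (suc i) (suc j) P ⇔ Between w i j P
between-∷ {a} {w} {i} {j} P = mk⇔ to from
  where
    to : Between (a ∷ w) (suc i) (suc j) P → Between w i j P
    to between (suc l) i<l l<j = between (suc (suc l)) (s≤s i<l) (s≤s l<j)
    from : Between w i j P → Between (a ∷ w) (suc i) (suc j) P
    from between (suc (suc l)) (s≤s i<l) (s≤s l<j) = between (suc l) i<l l<j

between-++ : ∀ p {q i j} P → Between (p ++ q) (length p + i) (length p + j) P ⇔ Between q i j P
between-++ []      P = mk⇔ (λ b → b) (λ b → b)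
between-++ (a ∷ p) P = mk⇔ (to (between-++ p P) ∘ to (between-∷ P)) (from (between-∷ P) ∘ from (between-++ p P))
  where open Equivalence

between-all : ∀ {P} ys {q} → Between (ys ++ q) 0 (suc (length ys)) P ⇔ All P ys
between-all {P} ys {q} = mk⇔ (to ys) (from ys)
  where
    to : ∀ ys → Between (ys ++ q) 0 (suc (length ys)) P → All P ys
    to []       _       = []
    to (y ∷ ys) between = between 1 (s≤s z≤n) (s≤s (s≤s z≤n)) ∷
      to ys (λ { (suc l) _ l<ys → between (suc (suc l)) (s≤s z≤n) (s≤s l<ys) })
    from : ∀ ys → All P ys → Between (ys ++ q) 0 (suc (length ys)) P
    from (y ∷ ys) (py ∷ _)   (suc zero)    _ _            = py
    from (y ∷ ys) (_ ∷ rest) (suc (suc l)) _ (s≤s l<ys) = from ys rest (suc l) (s≤s z≤n) l<ys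
    from []       []         (suc zero)    _ (s≤s ())

between-factor : ∀ pre (x : ℕ) ys q P →
  Between (pre ++ x ∷ ys ++ q) (length pre + 1) (length pre + suc (suc (length ys))) P ⇔ All P ys
between-factor pre x ys q P = begin
  Between (pre ++ x ∷ ys ++ q) (length pre + 1) (length pre + suc (suc (length ys))) P  ≈⟨ between-++ pre P ⟩
  Between (x ∷ ys ++ q) 1 (suc (suc (length ys))) P                                   ≈⟨ between-∷ P ⟩
  Between (ys ++ q) 0 (suc (length ys)) P                                             ≈⟨ between-all ys ⟩
  All P ys                                                                            ∎
  where open ⇔-Reasoning

Exceeded : List ℕ → ℕ → ℕ → Set
Exceeded w k y = ∀ j → k < j → j ≤ length w → y < w ! j

beyond-cut : ∀ u p x rest → Exceeded (u ∷ p ++ x ∷ rest) (suc (suc (length p))) x ⇔ All (x <_) rest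
beyond-cut u p x rest = begin
  Exceeded w (suc (suc (length p))) x
    ≈⟨ mk⇔ (λ f l k<l l<end → f l k<l (≤-pred l<end)) (λ f j k<j j≤w → f j k<j (s≤s j≤w)) ⟩
  Between w (suc (suc (length p))) (suc (length w)) (x <_)
    ≡⟨ cong₂ (λ i j → Between w i j (x <_)) (+-comm 1 (suc (length p))) end ⟩
  Between w (length (u ∷ p) + 1) (length (u ∷ p) + suc (suc (length rest))) (x <_)
    ≡⟨ cong (λ l → Between (u ∷ p ++ x ∷ l) (length (u ∷ p) + 1) (length (u ∷ p) + suc (suc (length rest))) (x <_))
            (sym (++-identityʳ rest)) ⟩
  Between ((u ∷ p) ++ x ∷ rest ++ []) (length (u ∷ p) + 1) (length (u ∷ p) + suc (suc (length rest))) (x <_)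
    ≈⟨ between-factor (u ∷ p) x rest [] (x <_) ⟩
  All (x <_) rest
    ∎
  where
    open ⇔-Reasoning
    w = u ∷ p ++ x ∷ rest
    end : suc (length w) ≡ length (u ∷ p) + suc (suc (length rest))
    end = cong suc (trans (cong suc (length-++ p)) (sym (+-suc (length p) (suc (length rest)))))

move⇒cut : ∀ u v m → ValidMove (u ∷ v) m →
  Σ (List ℕ) λ p → Σ ℕ λ x → Σ (List ℕ) λ rest →
    (v ≡ p ++ x ∷ rest) × (take m (u ∷ v) ≡ u ∷ p) × All (x <_) rest
move⇒cut u v (suc k) (_ , s≤s k<v , beyond) with split-at v k k<v
... | p , x , rest , refl , refl =
  p , x , rest , refl , cong (u ∷_) (take-length-++ p (x ∷ rest)) ,
  Equivalence.to (beyond-cut u p x rest) (subst (Exceeded (u ∷ p ++ x ∷ rest) _) (!-middle p x rest) beyond)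

cut⇒move : ∀ u p x rest → All (x <_) rest → ValidMove (u ∷ p ++ x ∷ rest) (suc (length p))
cut⇒move u p x rest x<rest =
  s≤s z≤n , s≤s (length-< p x rest) ,
  subst (Exceeded (u ∷ p ++ x ∷ rest) _) (sym (!-middle p x rest)) (Equivalence.from (beyond-cut u p x rest) x<rest)

-- The first letter is kept by every move, and u ∷ v is a
-- kernel position exactly when v is a chain for the relation z ≤ x: each
-- segment ends at the first letter not exceeding its head.
module L = Segments (λ x z → z ≤ x) (λ x z → z ≤? x)

kernel∧nonkernel⇒⊥ : ∀ {w} → Kernel w → NonKernel w → ⊥
kernel∧nonkernel⇒⊥ (kernel f) (nonkernel m move k) = kernel∧nonkernel⇒⊥ k (f m move)

blocked⇔above : ∀ {x rest} → L.Blocked x rest ⇔ All (x <_) rest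
blocked⇔above = mk⇔ (All.map ≰⇒>) (All.map <⇒≱)

-- A chain tail gives a kernel position: every move cuts the chain at a
-- letter x exceeded by all later letters, which cannot be a segment boundary,
-- so the remaining prefix has an obstruction and is a non-kernel position.
-- An obstruction gives a move to the chain before it.
chain⇒kernel : ∀ u v → Acc _<_ (length v) → L.Chain v → Kernel (u ∷ v)
obstruction⇒nonkernel : ∀ u p x rest → Acc _<_ (length p) →
  L.Chain p → L.Blocked x rest → NonKernel (u ∷ p ++ x ∷ rest)

chain⇒kernel u v (acc smaller) c = kernel answer
  where
    answer : ∀ m → ValidMove (u ∷ v) m → NonKernel (take m (u ∷ v))
    answer m move with move⇒cut u v m move
    ... | p , x , rest , refl , cut , x<rest with L.chain-or-obstruction p
    ...   | inj₁ cp with L.chain-suffix (x ∷ rest) cp c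
    ...     | L.cons s _ = ⊥-elim (L.blocked⇒no-segment (Equivalence.from blocked⇔above x<rest) s)
    answer m move | p , x , rest , refl , cut , x<rest
          | inj₂ (p′ , x′ , rest′ , refl , cp′ , blocked) =
      subst NonKernel (sym cut)
        (obstruction⇒nonkernel u p′ x′ rest′
          (smaller (<-trans (length-< p′ x′ rest′) (length-< p x rest))) cp′ blocked)

obstruction⇒nonkernel u p x rest a cp blocked =
  nonkernel (suc (length p)) (cut⇒move u p x rest (Equivalence.to blocked⇔above blocked))
    (subst Kernel (sym (cong (u ∷_) (take-length-++ p (x ∷ rest)))) (chain⇒kernel u p a cp))

kernel⇔chain : ∀ u v → Kernel (u ∷ v) ⇔ L.Chain v
kernel⇔chain u v = mk⇔ to (chain⇒kernel u v (<-wellFounded (length v)))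
  where
    to : Kernel (u ∷ v) → L.Chain v
    to k with L.chain-or-obstruction v
    ... | inj₁ c = c
    ... | inj₂ (p , x , rest , refl , cp , blocked) =
      ⊥-elim (kernel∧nonkernel⇒⊥ k (obstruction⇒nonkernel u p x rest (<-wellFounded (length p)) cp blocked))

BlockAt : List ℕ → ℕ → ℕ → Set
BlockAt π a b = (π ! b < π ! (a + 1)) × Between π (a + 1) b (π ! (a + 1) <_)

blockAt⇔ : ∀ pre x ys z r →
  BlockAt (pre ++ x ∷ ys ++ z ∷ r) (length pre) (length pre + suc (suc (length ys)))
    ⇔ ((z < x) × All (x <_) ys)
blockAt⇔ pre x ys z r = mk⇔
  (λ (z<x , between) → subst₂ _<_ last first z<x , to inside (subst (Between π _ _) (cong _<_ first) between))
  (λ (z<x , x<ys) → subst₂ _<_ (sym last) (sym first) z<x ,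
                     subst (Between π _ _) (cong _<_ (sym first)) (from inside x<ys))
  where
    open Equivalence
    π = pre ++ x ∷ ys ++ z ∷ r
    inside = between-factor pre x ys (z ∷ r) (x <_)
    first : π ! (length pre + 1) ≡ x
    first = !-++ pre _ 1 (s≤s z≤n)
    last : π ! (length pre + suc (suc (length ys))) ≡ z
    last = trans (!-++ pre _ (suc (suc (length ys))) (s≤s z≤n)) (!-middle ys z r)

data Blocks (π : List ℕ) : ℕ → Set where
  done : Blocks π (length π)
  step : ∀ {a b} → a < b → BlockAt π a b → Blocks π b → Blocks π a

blocks-bounded : ∀ {π a} → Blocks π a → a ≤ length π
blocks-bounded done               = ≤-refl
blocks-bounded (step a<b _ rest) = <⇒≤ (<-≤-trans a<b (blocks-bounded rest))

-- The block condition from position a on, with the blocks given by their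
-- end positions i 0 = a < i 1 < ⋯ < i (k+1) = |π|; for a = 0 this is
-- BlockCondition |π| π.
BlockFrom : List ℕ → ℕ → Set
BlockFrom π a =
  Σ ℕ λ k → Σ (ℕ → ℕ) λ i →
    (i 0 ≡ a) × (i (suc k) ≡ length π) × (∀ j → j ≤ k → i j < i (suc j)) ×
    (∀ j → j ≤ k → BlockAt π (i j) (i (suc j)))

blockFrom⇒blocks : ∀ {π a} → BlockFrom π a → Blocks π a
blockFrom⇒blocks {π} (k , i , refl , last , increasing , blocks) = go k i last increasing blocks
  where
    go : ∀ k (i : ℕ → ℕ) → i (suc k) ≡ length π → (∀ j → j ≤ k → i j < i (suc j)) →
         (∀ j → j ≤ k → BlockAt π (i j) (i (suc j))) → Blocks π (i 0)
    go zero    i last increasing blocks =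
      step (increasing 0 z≤n) (blocks 0 z≤n) (subst (Blocks π) (sym last) done)
    go (suc k) i last increasing blocks =
      step (increasing 0 z≤n) (blocks 0 z≤n)
        (go k (i ∘ suc) last (λ j j≤k → increasing (suc j) (s≤s j≤k)) (λ j j≤k → blocks (suc j) (s≤s j≤k)))

blocks⇒blockFrom : ∀ {π a b} → a < b → BlockAt π a b → Blocks π b → BlockFrom π a
blocks⇒blockFrom {π} {a} a<b block done = 0 , i , refl , refl , (λ { zero _ → a<b }) , (λ { zero _ → block })
  where
    i : ℕ → ℕ
    i zero    = a
    i (suc _) = length π
blocks⇒blockFrom {π} {a} a<b block (step b<c block′ rest) with blocks⇒blockFrom b<c block′ rest
... | k , i′ , refl , last , increasing , blocks =
  suc k , i , refl , last ,
  (λ { zero _ → a<b ; (suc j) (s≤s j≤k) → increasing j j≤k }) ,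
  (λ { zero _ → block ; (suc j) (s≤s j≤k) → blocks j j≤k })
  where
    i : ℕ → ℕ
    i zero    = a
    i (suc j) = i′ j

-- Blocks are segments for the relation z < x: a block x ys z of a list
-- with distinct letters has every letter of ys above x (not below and
-- different) and z below x.
module S = Segments (λ x z → z < x) (λ x z → z <? x)

drop-++ : ∀ (p q : List ℕ) k → drop (length p + k) (p ++ q) ≡ drop k q
drop-++ []      q k = refl
drop-++ (a ∷ p) q k = drop-++ p q k

drop-past : ∀ ys (z : ℕ) r → drop (suc (length ys)) (ys ++ z ∷ r) ≡ r
drop-past []       z r = refl
drop-past (y ∷ ys) z r = drop-past ys z r

split-block : ∀ π a d → a + suc (suc d) ≤ length π →
  Σ (List ℕ) λ pre → Σ ℕ λ x → Σ (List ℕ) λ ys → Σ ℕ λ z → Σ (List ℕ) λ r →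
    (π ≡ pre ++ x ∷ ys ++ z ∷ r) × (length pre ≡ a) × (length ys ≡ d)
split-block π a d fits with split-at π a (<-≤-trans (m<m+n a (s≤s z≤n)) fits)
... | pre , x , rest , refl , refl with split-at rest d d<rest
  where
    d<rest : d < length rest
    d<rest = +-cancelˡ-≤ (suc (length pre)) _ _
               (subst₂ _≤_ (+-suc (length pre) (suc d)) (trans (length-++ pre) (+-suc (length pre) (length rest))) fits)
...   | ys , z , r , refl , refl = pre , x , ys , z , r , refl , refl , refl

chain⇒blocks : ∀ pre t → S.Chain t → Unique t → Blocks (pre ++ t) (length pre)
chain⇒blocks pre [] S.nil _ = subst (Blocks (pre ++ [])) (cong length (++-identityʳ pre)) done
chain⇒blocks pre (x ∷ t) (S.cons {r = r} s c) (x∉t ∷ u) with S.segment⇒split s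
... | ys , z , refl , blocked , z<x =
  step (m<m+n (length pre) (s≤s z≤n)) (Equivalence.from (blockAt⇔ pre x ys z r) (z<x , x<ys))
    (subst₂ Blocks factor length-factor
      (chain⇒blocks (pre ++ x ∷ ys ++ z ∷ []) r c (S.unique-after-segment s u)))
  where
    x<ys : All (x <_) ys
    x<ys = All.zipWith (λ (x≢y , y≮x) → ≤∧≢⇒< (≮⇒≥ y≮x) x≢y) (AllP.++⁻ˡ ys x∉t , blocked)
    factor : (pre ++ x ∷ ys ++ z ∷ []) ++ r ≡ pre ++ x ∷ ys ++ z ∷ r
    factor = trans (++-assoc pre _ r) (cong (λ l → pre ++ x ∷ l) (++-assoc ys (z ∷ []) r))
    length-factor : length (pre ++ x ∷ ys ++ z ∷ []) ≡ length pre + suc (suc (length ys))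
    length-factor = trans (length-++ pre) (cong (λ k → length pre + suc k) (trans (length-++ ys) (+-comm (length ys) 1)))

blocks⇒chain : ∀ {π a} → Blocks π a → S.Chain (drop a π)
blocks⇒chain {π} done = subst S.Chain (sym (drop-all (length π) π ≤-refl)) S.nil
blocks⇒chain {π} {a} (step a<b block rest) with m≤n⇒∃[o]m+o≡n (<⇒≤ a<b)
... | zero , refl = ⊥-elim (<-irrefl refl (subst (a <_) (+-identityʳ a) a<b))
... | suc zero , refl = ⊥-elim (<-irrefl refl (proj₁ block))
... | suc (suc d) , refl with split-block π a d (blocks-bounded rest)
...   | pre , x , ys , z , r , refl , refl , refl with Equivalence.to (blockAt⇔ pre x ys z r) block
...     | z<x , x<ys =
  subst S.Chain (sym drop-pre)
    (S.cons (S.split⇒segment r (All.map <⇒≯ x<ys) z<x)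
      (subst S.Chain (trans (drop-++ pre _ (suc (suc (length ys)))) (drop-past ys z r)) (blocks⇒chain rest)))
  where
    drop-pre : drop (length pre) (pre ++ x ∷ ys ++ z ∷ r) ≡ x ∷ ys ++ z ∷ r
    drop-pre = trans (cong (λ k → drop k (pre ++ x ∷ ys ++ z ∷ r)) (sym (+-identityʳ (length pre)))) (drop-++ pre _ 0)

blockCondition⇔chain : ∀ π → 1 ≤ length π → Unique π → BlockCondition (length π) π ⇔ S.Chain π
blockCondition⇔chain (x ∷ π) _ u = mk⇔ (blocks⇒chain ∘ blockFrom⇒blocks) from
  where
    from : S.Chain (x ∷ π) → BlockCondition (length (x ∷ π)) (x ∷ π)
    from c with chain⇒blocks [] (x ∷ π) c u
    ... | step a<b block rest = blocks⇒blockFrom a<b block rest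

count≤ : ℕ → List ℕ → ℕ
count≤ y l = length (filter (_≤? y) l)

count≤-accept : ∀ {s y} l → s ≤ y → count≤ y (s ∷ l) ≡ suc (count≤ y l)
count≤-accept l s≤y = cong length (filter-accept (_≤? _) {xs = l} s≤y)

count≤-reject : ∀ {s y} l → ¬ s ≤ y → count≤ y (s ∷ l) ≡ count≤ y l
count≤-reject l s≰y = cong length (filter-reject (_≤? _) {xs = l} s≰y)

count≤-++ : ∀ y l l′ → count≤ y (l ++ l′) ≡ count≤ y l + count≤ y l′
count≤-++ y l l′ = trans (cong length (filter-++ (_≤? y) l l′)) (length-++ (filter (_≤? y) l))

count≤-↭ : ∀ y {l l′} → l ↭ l′ → count≤ y l ≡ count≤ y l′
count≤-↭ y p = ↭-length (filter-↭ (_≤? y) p)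

count≤-length : ∀ y l → count≤ y l ≤ length l
count≤-length y l = length-filter (_≤? y) l

count≤-all : ∀ {y} l → All (_≤ y) l → count≤ y l ≡ length l
count≤-all l l≤y = cong length (filter-all (_≤? _) l≤y)

count≤-none : ∀ {y} l → All (y <_) l → count≤ y l ≡ 0
count≤-none l y<l = cong length (filter-none (_≤? _) (All.map <⇒≱ y<l))

count≤-∷ : ∀ {y y′} m s l → (s ≤ y → s ≤ y′) →
  m + count≤ y l ≤ count≤ y′ l → m + count≤ y (s ∷ l) ≤ count≤ y′ (s ∷ l)
count≤-∷ {y} {y′} m s l counted le with s ≤? y | s ≤? y′
... | yes s≤y | _ = subst₂ _≤_ (cong (m +_) (sym (count≤-accept l s≤y))) (sym (count≤-accept l (counted s≤y)))
                      (subst (_≤ suc (count≤ y′ l)) (sym (+-suc m _)) (s≤s le))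
... | no s≰y | yes s≤y′ = subst₂ _≤_ (cong (m +_) (sym (count≤-reject l s≰y))) (sym (count≤-accept l s≤y′))
                            (m≤n⇒m≤1+n le)
... | no s≰y | no s≰y′ = subst₂ _≤_ (cong (m +_) (sym (count≤-reject l s≰y))) (sym (count≤-reject l s≰y′)) le

count≤-mono : ∀ {y y′} l → y ≤ y′ → count≤ y l ≤ count≤ y′ l
count≤-mono []      _    = z≤n
count≤-mono (s ∷ l) y≤y′ = count≤-∷ 0 s l (λ s≤y → ≤-trans s≤y y≤y′) (count≤-mono l y≤y′)

count≤-strict : ∀ {a b} l → a < b → b ∈ l → count≤ a l < count≤ b l
count≤-strict {a} {b} (s ∷ l) a<b (here refl) =
  subst₂ _<_ (sym (count≤-reject l (<⇒≱ a<b))) (sym (count≤-accept l ≤-refl)) (s≤s (count≤-mono l (<⇒≤ a<b)))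
count≤-strict {a} {b} (s ∷ l) a<b (there b∈l) =
  count≤-∷ 1 s l (λ s≤a → ≤-trans s≤a (<⇒≤ a<b)) (count≤-strict l a<b b∈l)

count≤-injective : ∀ {a b l} → a ∈ l → b ∈ l → count≤ a l ≡ count≤ b l → a ≡ b
count≤-injective {a} {b} {l} a∈l b∈l same with <-cmp a b
... | tri< a<b _ _ = ⊥-elim (<-irrefl same (count≤-strict l a<b b∈l))
... | tri≈ _ a≡b _ = a≡b
... | tri> _ _ b<a = ⊥-elim (<-irrefl (sym same) (count≤-strict l b<a a∈l))

codeAfter : List ℕ → List ℕ → List ℕ
codeAfter s []       = []
codeAfter s (x ∷ xs) = suc (count≤ x s) ∷ codeAfter (x ∷ s) xs

code : List ℕ → List ℕ
code = codeAfter []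

code-length : ∀ s τ → length (codeAfter s τ) ≡ length τ
code-length s []       = refl
code-length s (x ∷ τ) = cong suc (code-length (x ∷ s) τ)

codeAfter-bounds : ∀ s τ i → 1 ≤ i → i ≤ length τ →
  (1 ≤ codeAfter s τ ! i) × (codeAfter s τ ! i ≤ length s + i)
codeAfter-bounds s (x ∷ τ) (suc zero) _ _ =
  s≤s z≤n , subst (suc (count≤ x s) ≤_) (+-comm 1 (length s)) (s≤s (count≤-length x s))
codeAfter-bounds s (x ∷ τ) (suc (suc i)) _ (s≤s i≤τ) with codeAfter-bounds (x ∷ s) τ (suc i) (s≤s z≤n) i≤τ
... | positive , bounded = positive , subst (codeAfter (x ∷ s) τ ! suc i ≤_) (sym (+-suc (length s) (suc i))) bounded

code-position : ∀ τ → IsPosition (code τ)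
code-position τ i 1≤i i≤code = codeAfter-bounds [] τ i 1≤i (subst (i ≤_) (code-length [] τ) i≤code)

-- Codes of concatenations; the letters of xs precede ys in reverse order.
codeAfter-++ : ∀ s xs ys → codeAfter s (xs ++ ys) ≡ codeAfter s xs ++ codeAfter (xs ʳ++ s) ys
codeAfter-++ s []       ys = refl
codeAfter-++ s (x ∷ xs) ys = cong (_ ∷_) (codeAfter-++ (x ∷ s) xs ys)

code-∷ʳ : ∀ σ y → code (σ ∷ʳ y) ≡ code σ ∷ʳ suc (count≤ y σ)
code-∷ʳ σ y = trans (codeAfter-++ [] σ (y ∷ [])) (cong (λ k → code σ ∷ʳ suc k) (count≤-↭ y reversed))
  where
    reversed : σ ʳ++ [] ↭ σ
    reversed = ↭-trans (↭-reflexive (trans (ʳ++-defn σ) (++-identityʳ _))) (↭-reverse σ)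

module _ (f : ℕ → ℕ) (f-mono : ∀ {a b} → a < b → f a < f b) where

  -- f preserves and reflects ≤, so the counts of all letters are unchanged.
  f-≤ : ∀ {a b} → a ≤ b → f a ≤ f b
  f-≤ a≤b with m≤n⇒m<n∨m≡n a≤b
  ... | inj₁ a<b  = <⇒≤ (f-mono a<b)
  ... | inj₂ refl = ≤-refl

  count≤-map : ∀ y l → count≤ (f y) (map f l) ≡ count≤ y l
  count≤-map y []      = refl
  count≤-map y (s ∷ l) with s ≤? y
  ... | yes s≤y = trans (count≤-accept (map f l) (f-≤ s≤y))
                    (trans (cong suc (count≤-map y l)) (sym (count≤-accept l s≤y)))
  ... | no s≰y  = trans (count≤-reject (map f l) (<⇒≱ (f-mono (≰⇒> s≰y))))
                    (trans (count≤-map y l) (sym (count≤-reject l s≰y)))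

  codeAfter-map : ∀ s xs → codeAfter (map f s) (map f xs) ≡ codeAfter s xs
  codeAfter-map s []       = refl
  codeAfter-map s (x ∷ xs) = cong₂ _∷_ (cong suc (count≤-map x s)) (codeAfter-map (x ∷ s) xs)

-- Within a segment with head x (preceded by the letters B), a later letter y
-- is preceded by B, x and letters E all above x.
below⇔code≤ : ∀ {x y} B E → All (x <_) E → x ≢ y → y < x ⇔ count≤ y (E ++ x ∷ B) ≤ count≤ x B
below⇔code≤ {x} {y} B E x<E x≢y = mk⇔ to from
  where
    to : y < x → count≤ y (E ++ x ∷ B) ≤ count≤ x B
    to y<x = begin
      count≤ y (E ++ x ∷ B)           ≡⟨ count≤-++ y E (x ∷ B) ⟩
      count≤ y E + count≤ y (x ∷ B)   ≡⟨ cong₂ _+_ (count≤-none E (All.map (<-trans y<x) x<E)) (count≤-reject B (<⇒≱ y<x)) ⟩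
      count≤ y B                      ≤⟨ count≤-mono B (<⇒≤ y<x) ⟩
      count≤ x B                      ∎
      where open ≤-Reasoning
    from : count≤ y (E ++ x ∷ B) ≤ count≤ x B → y < x
    from code≤ with <-cmp y x
    ... | tri< y<x _ _ = y<x
    ... | tri≈ _ y≡x _ = ⊥-elim (x≢y (sym y≡x))
    ... | tri> _ _ x<y = ⊥-elim (<⇒≱ (begin-strict
      count≤ x B                      <⟨ s≤s ≤-refl ⟩
      suc (count≤ x B)                ≡⟨ count≤-accept B ≤-refl ⟨
      count≤ x (x ∷ B)                ≤⟨ count≤-mono (x ∷ B) (<⇒≤ x<y) ⟩
      count≤ y (x ∷ B)                ≤⟨ m≤n+m _ (count≤ y E) ⟩
      count≤ y E + count≤ y (x ∷ B)   ≡⟨ count≤-++ y E (x ∷ B) ⟨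
      count≤ y (E ++ x ∷ B)           ∎) code≤)
      where open ≤-Reasoning

segment⇒code-segment : ∀ {x t r} E B → All (x <_) E → All (x ≢_) t → S.Segment x t r →
  Σ (List ℕ) λ M → L.Segment (suc (count≤ x B)) (codeAfter (E ++ x ∷ B) t) (codeAfter M r)
segment⇒code-segment E B x<E (x≢z ∷ _) (S.stop z<x) =
  _ , L.stop (s≤s (Equivalence.to (below⇔code≤ B E x<E x≢z) z<x))
segment⇒code-segment {x} E B x<E (x≢y ∷ x≢t) (S.skip {y} y≮x s)
  with segment⇒code-segment (y ∷ E) B (≤∧≢⇒< (≮⇒≥ y≮x) x≢y ∷ x<E) x≢t s
... | M , s′ = M , L.skip (λ code≤ → y≮x (Equivalence.from (below⇔code≤ B E x<E x≢y) (≤-pred code≤))) s′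

code-segment⇒segment : ∀ {r′} E B x t → All (x <_) E → All (x ≢_) t →
  L.Segment (suc (count≤ x B)) (codeAfter (E ++ x ∷ B) t) r′ →
  Σ (List ℕ) λ r → Σ (List ℕ) λ M → S.Segment x t r × (r′ ≡ codeAfter M r)
code-segment⇒segment E B x (y ∷ t) x<E (x≢y ∷ _) (L.stop code≤) =
  t , _ , S.stop (Equivalence.from (below⇔code≤ B E x<E x≢y) (≤-pred code≤)) , refl
code-segment⇒segment {r′} E B x (y ∷ t) x<E (x≢y ∷ x≢t) (L.skip code≰ s) =
  skipping (λ y<x → code≰ (s≤s (Equivalence.to (below⇔code≤ B E x<E x≢y) y<x)))
  where
    skipping : ¬ y < x → Σ (List ℕ) λ r → Σ (List ℕ) λ M → S.Segment x (y ∷ t) r × (r′ ≡ codeAfter M r)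
    skipping y≮x with code-segment⇒segment (y ∷ E) B x t (≤∧≢⇒< (≮⇒≥ y≮x) x≢y ∷ x<E) x≢t s
    ... | r , M , s′ , refl = r , M , S.skip y≮x s′ , refl

chain⇒code-chain : ∀ {τ} → S.Chain τ → ∀ s → Unique τ → L.Chain (codeAfter s τ)
chain⇒code-chain S.nil s _ = L.nil
chain⇒code-chain (S.cons seg c) s (x∉t ∷ u) with segment⇒code-segment [] s [] x∉t seg
... | M , seg′ = L.cons seg′ (chain⇒code-chain c M (S.unique-after-segment seg u))

code-chain⇒chain : ∀ {l} → L.Chain l → ∀ s τ → l ≡ codeAfter s τ → Unique τ → S.Chain τ
code-chain⇒chain L.nil s [] _ _ = S.nil
code-chain⇒chain (L.cons seg c) s (x ∷ t) refl (x∉t ∷ u) with code-segment⇒segment [] s x t [] x∉t seg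
... | r , M , seg′ , refl = S.cons seg′ (code-chain⇒chain c M r refl (S.unique-after-segment seg′ u))

chain⇔code-chain : ∀ s τ → Unique τ → S.Chain τ ⇔ L.Chain (codeAfter s τ)
chain⇔code-chain s τ u = mk⇔ (λ c → chain⇒code-chain c s u) (λ c → code-chain⇒chain c s τ refl u)

oneTo : ℕ → List ℕ
oneTo n = map suc (upTo n)

oneTo-∷ʳ : ∀ n → oneTo (suc n) ≡ oneTo n ∷ʳ suc n
oneTo-∷ʳ n = trans (cong (map suc) (sym (upTo-∷ʳ n))) (map-++ suc (upTo n) (n ∷ []))

oneTo-length : ∀ n → length (oneTo n) ≡ n
oneTo-length n = trans (length-map suc (upTo n)) (length-upTo n)

oneTo-unique : ∀ n → Unique (oneTo n)
oneTo-unique n = UP.map⁺ suc-injective (UP.upTo⁺ n)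

∈-oneTo⁺ : ∀ {n x} → 1 ≤ x → x ≤ n → x ∈ oneTo n
∈-oneTo⁺ {n} {suc x} _ x<n = ∈-map⁺ suc (∈-upTo⁺ x<n)

∈-oneTo⁻ : ∀ {n x} → x ∈ oneTo n → (1 ≤ x) × (x ≤ n)
∈-oneTo⁻ x∈ with ∈-map⁻ suc x∈
... | y , y∈ , refl = s≤s z≤n , ∈-upTo⁻ y∈

count≤-oneTo : ∀ k n → k ≤ n → count≤ k (oneTo n) ≡ k
count≤-oneTo k zero    z≤n  = refl
count≤-oneTo k (suc n) k≤1+n = begin
  count≤ k (oneTo (suc n))                    ≡⟨ cong (count≤ k) (oneTo-∷ʳ n) ⟩
  count≤ k (oneTo n ∷ʳ suc n)                 ≡⟨ count≤-++ k (oneTo n) (suc n ∷ []) ⟩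
  count≤ k (oneTo n) + count≤ k (suc n ∷ [])  ≡⟨ last-step (m≤n⇒m<n∨m≡n k≤1+n) ⟩
  k                                           ∎
  where
    open ≡-Reasoning
    last-step : k < suc n ⊎ k ≡ suc n → count≤ k (oneTo n) + count≤ k (suc n ∷ []) ≡ k
    last-step (inj₁ (s≤s k≤n)) =
      trans (cong₂ _+_ (count≤-oneTo k n k≤n) (count≤-reject [] (<⇒≱ (s≤s k≤n)))) (+-identityʳ k)
    last-step (inj₂ refl) =
      trans (cong₂ _+_ (trans (count≤-all (oneTo n) (All.tabulate (m≤n⇒m≤1+n ∘ proj₂ ∘ ∈-oneTo⁻))) (oneTo-length n))
                       (count≤-accept {suc n} [] ≤-refl))
            (+-comm n 1)

-- bump c moves the letters c, c+1, … up by one, making room for a new letter c.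
bump : ℕ → ℕ → ℕ
bump c y with c ≤? y
... | yes _ = suc y
... | no _  = y

bump-below : ∀ {c y} → y < c → bump c y ≡ y
bump-below {c} {y} y<c with c ≤? y
... | yes c≤y = ⊥-elim (<⇒≱ y<c c≤y)
... | no _    = refl

bump-above : ∀ {c y} → c ≤ y → bump c y ≡ suc y
bump-above {c} {y} c≤y with c ≤? y
... | yes _   = refl
... | no c≰y = ⊥-elim (c≰y c≤y)

bump-mono : ∀ c {a b} → a < b → bump c a < bump c b
bump-mono c {a} {b} a<b with c ≤? a | c ≤? b
... | yes _   | yes _   = s≤s a<b
... | yes c≤a | no c≰b  = ⊥-elim (c≰b (≤-trans c≤a (<⇒≤ a<b)))
... | no _    | yes _   = m≤n⇒m≤1+n a<b
... | no _    | no _    = a<b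

bump-injective : ∀ c {a b} → bump c a ≡ bump c b → a ≡ b
bump-injective c {a} {b} same with <-cmp a b
... | tri< a<b _ _ = ⊥-elim (<-irrefl same (bump-mono c a<b))
... | tri≈ _ a≡b _ = a≡b
... | tri> _ _ b<a = ⊥-elim (<-irrefl (sym same) (bump-mono c b<a))

unbump : ℕ → ℕ → ℕ
unbump c y with c <? y
... | yes _ = pred y
... | no _  = y

unbump-bump : ∀ c y → unbump c (bump c y) ≡ y
unbump-bump c y with c ≤? y
... | yes c≤y with c <? suc y
...   | yes _ = refl
...   | no c≮1+y = ⊥-elim (c≮1+y (s≤s c≤y))
unbump-bump c y | no c≰y with c <? y
...   | yes c<y = ⊥-elim (c≰y (<⇒≤ c<y))
...   | no _    = refl

bump-unbump : ∀ c y → c ≢ y → bump c (unbump c y) ≡ y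
bump-unbump c y c≢y with c <? y
bump-unbump c (suc y) c≢y | yes (s≤s c≤y) = bump-above c≤y
bump-unbump c y       c≢y | no c≮y        = bump-below (≤∧≢⇒< (≮⇒≥ c≮y) (≢-sym c≢y))

count≤-bump : ∀ c l → 1 ≤ c → count≤ c (map (bump c) l) ≡ count≤ (pred c) l
count≤-bump c       []      _   = refl
count≤-bump (suc c) (s ∷ l) 1≤c with s ≤? c
... | yes s≤c = trans (count≤-accept (map (bump (suc c)) l)
                        (≤-trans (≤-reflexive (bump-below (s≤s s≤c))) (m≤n⇒m≤1+n s≤c)))
                  (trans (cong suc (count≤-bump (suc c) l 1≤c)) (sym (count≤-accept l s≤c)))
... | no s≰c  = trans (count≤-reject (map (bump (suc c)) l)
                        (<⇒≱ (subst (suc c <_) (sym (bump-above (≰⇒> s≰c))) (s≤s (≰⇒> s≰c)))))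
                  (trans (count≤-bump (suc c) l 1≤c) (sym (count≤-reject l s≰c)))

bump-oneTo : ∀ n c → 1 ≤ c → c ≤ suc n → c ∷ map (bump c) (oneTo n) ↭ oneTo (suc n)
bump-oneTo zero    (suc zero) _ _ = ↭-refl
bump-oneTo zero    (suc (suc c)) _ (s≤s ())
bump-oneTo (suc n) c 1≤c c≤2+n with m≤n⇒m<n∨m≡n c≤2+n
... | inj₂ refl = begin
  c ∷ map (bump c) (oneTo (suc n))  ≡⟨ cong (c ∷_) (map-id-local (All.tabulate (bump-below ∘ s≤s ∘ proj₂ ∘ ∈-oneTo⁻))) ⟩
  c ∷ oneTo (suc n)                  ↭⟨ ∷↭∷ʳ c (oneTo (suc n)) ⟩
  oneTo (suc n) ∷ʳ c                 ≡⟨ oneTo-∷ʳ (suc n) ⟨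
  oneTo (suc (suc n))                ∎
  where open PermutationReasoning
... | inj₁ (s≤s c≤1+n) = begin
  c ∷ map (bump c) (oneTo (suc n))          ≡⟨ cong (λ l → c ∷ map (bump c) l) (oneTo-∷ʳ n) ⟩
  c ∷ map (bump c) (oneTo n ∷ʳ suc n)       ≡⟨ cong (c ∷_) (map-++ (bump c) (oneTo n) (suc n ∷ [])) ⟩
  c ∷ map (bump c) (oneTo n) ∷ʳ bump c (suc n)  ≡⟨ cong (λ y → c ∷ map (bump c) (oneTo n) ∷ʳ y) (bump-above c≤1+n) ⟩
  (c ∷ map (bump c) (oneTo n)) ∷ʳ suc (suc n)   ↭⟨ ++⁺ʳ (suc (suc n) ∷ []) (bump-oneTo n c 1≤c c≤1+n) ⟩
  oneTo (suc n) ∷ʳ suc (suc n)               ≡⟨ oneTo-∷ʳ (suc n) ⟨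
  oneTo (suc (suc n))                        ∎
  where open PermutationReasoning

unique-↭ : ∀ {l l′ : List ℕ} → l ↭ l′ → Unique l → Unique l′
unique-↭ p = SetoidPerm.Unique-resp-↭ (↭⇒↭ₛ p)

perm-unique : ∀ {n π} → π ↭ oneTo n → Unique π
perm-unique {n} p = unique-↭ (↭-sym p) (oneTo-unique n)

-- A permutation of 1, …, n+1 is a first letter c followed by a bumped
-- permutation of 1, …, n.
extend : ℕ × List ℕ → List ℕ
extend (c , π) = c ∷ map (bump c) π

extend-↭ : ∀ {n c π} → c ∈ oneTo (suc n) → π ↭ oneTo n → extend (c , π) ↭ oneTo (suc n)
extend-↭ {n} {c} c∈ p with ∈-oneTo⁻ c∈
... | 1≤c , c≤1+n = ↭-trans (prep c (map⁺ (bump c) p)) (bump-oneTo n c 1≤c c≤1+n)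

extend-injective : ∀ {a b} → extend a ≡ extend b → a ≡ b
extend-injective {c , π} {c′ , π′} same with ∷-injective same
... | refl , bumped = cong (c ,_) (map-injective (bump-injective c) bumped)

↭-extend : ∀ {n τ} → τ ↭ oneTo (suc n) →
  Σ ℕ λ c → Σ (List ℕ) λ π → (c ∈ oneTo (suc n)) × (π ↭ oneTo n) × (τ ≡ extend (c , π))
↭-extend {n} {[]}    p = ⊥-elim (¬x∷xs↭[] (↭-sym p))
↭-extend {n} {c ∷ σ} p with perm-unique p
... | c∉σ ∷ _ = c , map (unbump c) σ , c∈ , unbumped , cong (c ∷_) (sym rebumped)
  where
    c∈ : c ∈ oneTo (suc n)
    c∈ = ∈-resp-↭ p (here refl)
    bounds = ∈-oneTo⁻ c∈
    rebumped : map (bump c) (map (unbump c) σ) ≡ σ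
    rebumped = trans (sym (map-∘ σ)) (map-id-local (All.map (bump-unbump c _) c∉σ))
    unbumped : map (unbump c) σ ↭ oneTo n
    unbumped = subst (map (unbump c) σ ↭_)
                 (trans (sym (map-∘ (oneTo n))) (trans (map-cong (unbump-bump c) (oneTo n)) (map-id (oneTo n))))
                 (map⁺ (unbump c) (drop-∷ (↭-trans p (↭-sym (bump-oneTo n c (proj₁ bounds) (proj₂ bounds))))))

perms : ℕ → List (List ℕ)
perms zero    = [] ∷ []
perms (suc n) = map extend (cartesianProduct (oneTo (suc n)) (perms n))

∈-perms⇔ : ∀ n π → (π ∈ perms n) ⇔ (π ↭ oneTo n)
∈-perms⇔ n π = mk⇔ (sound n) (complete n)
  where
    sound : ∀ n {π} → π ∈ perms n → π ↭ oneTo n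
    sound zero    (here refl) = ↭-refl
    sound (suc n) π∈ with ∈-map⁻ extend π∈
    ... | (c , π′) , cπ′∈ , refl with ∈-cartesianProduct⁻ (oneTo (suc n)) (perms n) cπ′∈
    ...   | c∈ , π′∈ = extend-↭ c∈ (sound n π′∈)
    complete : ∀ n {π} → π ↭ oneTo n → π ∈ perms n
    complete zero    p = subst (_∈ perms zero) (sym (↭-empty-inv p)) (here refl)
    complete (suc n) p with ↭-extend p
    ... | c , π′ , c∈ , p′ , refl = ∈-map⁺ extend (∈-cartesianProduct⁺ c∈ (complete n p′))

perms-unique : ∀ n → Unique (perms n)
perms-unique zero    = [] ∷ []
perms-unique (suc n) = UP.map⁺ extend-injective (UP.cartesianProduct⁺ (oneTo-unique (suc n)) (perms-unique n))

length-∷ʳ : ∀ (w : List ℕ) x → length (w ∷ʳ x) ≡ suc (length w)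
length-∷ʳ w x = trans (length-++ w) (+-comm (length w) 1)

isPosition-∷ʳ : ∀ w x → IsPosition (w ∷ʳ x) → IsPosition w × (1 ≤ x) × (x ≤ suc (length w))
isPosition-∷ʳ w x pos =
  prefix , subst (λ v → (1 ≤ v) × (v ≤ suc (length w))) last
             (pos (suc (length w)) (s≤s z≤n) (≤-reflexive (sym (length-∷ʳ w x))))
  where
    last : (w ∷ʳ x) ! suc (length w) ≡ x
    last = !-middle w x []
    prefix : IsPosition w
    prefix i 1≤i i≤w = subst (λ v → (1 ≤ v) × (v ≤ i)) (!-++ˡ w (x ∷ []) i 1≤i i≤w)
                         (pos i 1≤i (≤-trans i≤w (≤-trans (n≤1+n _) (≤-reflexive (sym (length-∷ʳ w x))))))

-- A new last letter x ≤ N+1 is realised by bumping a permutation of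
-- 1, …, N at x and appending x, which then has exactly x-1 smaller letters.
code-surjective : ∀ {w} → Reverse w → IsPosition w →
  Σ (List ℕ) λ τ → (τ ↭ oneTo (length w)) × (code τ ≡ w)
code-surjective [] _ = [] , ↭-refl , refl
code-surjective (w ∶ rw ∶ʳ x) pos with isPosition-∷ʳ w x pos
... | pos′ , 1≤x@(s≤s z≤n) , x≤1+w with code-surjective rw pos′
...   | τ , p , refl = map (bump x) τ ∷ʳ x , permutation , coded
  where
    permutation : map (bump x) τ ∷ʳ x ↭ oneTo (length (code τ ∷ʳ x))
    permutation = subst (λ n → map (bump x) τ ∷ʳ x ↭ oneTo n) (sym (length-∷ʳ (code τ) x))
                    (↭-trans (↭-sym (∷↭∷ʳ x _)) (extend-↭ (∈-oneTo⁺ 1≤x x≤1+w) p))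
    rank : count≤ x (map (bump x) τ) ≡ pred x
    rank = trans (count≤-bump x τ 1≤x) (trans (count≤-↭ (pred x) p) (count≤-oneTo (pred x) _ (≤-pred x≤1+w)))
    coded : code (map (bump x) τ ∷ʳ x) ≡ code τ ∷ʳ x
    coded = begin
      code (map (bump x) τ ∷ʳ x)
        ≡⟨ code-∷ʳ (map (bump x) τ) x ⟩
      code (map (bump x) τ) ∷ʳ suc (count≤ x (map (bump x) τ))
        ≡⟨ cong₂ (λ c k → c ∷ʳ suc k) (codeAfter-map (bump x) (bump-mono x) [] τ) rank ⟩
      code τ ∷ʳ x
        ∎
      where open ≡-Reasoning

-- The last letters agree: both have the same rank among the common letters.
last-letter : ∀ {σ σ′ y y′} → σ ∷ʳ y ↭ σ′ ∷ʳ y′ → count≤ y σ ≡ count≤ y′ σ′ → y ≡ y′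
last-letter {σ} {σ′} {y} {y′} p same = count≤-injective y∈ y′∈ (begin
  count≤ y (σ ∷ʳ y)      ≡⟨ count≤-∷ʳ-self σ y ⟩
  suc (count≤ y σ)       ≡⟨ cong suc same ⟩
  suc (count≤ y′ σ′)     ≡⟨ count≤-∷ʳ-self σ′ y′ ⟨
  count≤ y′ (σ′ ∷ʳ y′)   ≡⟨ count≤-↭ y′ p ⟨
  count≤ y′ (σ ∷ʳ y)     ∎)
  where
    open ≡-Reasoning
    count≤-∷ʳ-self : ∀ σ y → count≤ y (σ ∷ʳ y) ≡ suc (count≤ y σ)
    count≤-∷ʳ-self σ y =
      trans (count≤-++ y σ (y ∷ [])) (trans (cong (count≤ y σ +_) (count≤-accept {y} [] ≤-refl)) (+-comm _ 1))
    y∈ : y ∈ σ ∷ʳ y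
    y∈ = ∈-++⁺ʳ σ (here refl)
    y′∈ : y′ ∈ σ ∷ʳ y
    y′∈ = ∈-resp-↭ (↭-sym p) (∈-++⁺ʳ σ′ (here refl))

code-injective : ∀ {τ τ′} → Reverse τ → Reverse τ′ → τ ↭ τ′ → code τ ≡ code τ′ → τ ≡ τ′
code-injective [] [] _ _ = refl
code-injective [] (σ′ ∶ _ ∶ʳ y′) p _ = ⊥-elim (0≢1+n (trans (↭-length p) (length-∷ʳ σ′ y′)))
code-injective (σ ∶ _ ∶ʳ y) [] p _ = ⊥-elim (0≢1+n (trans (sym (↭-length p)) (length-∷ʳ σ y)))
code-injective (σ ∶ rσ ∶ʳ y) (σ′ ∶ rσ′ ∶ʳ y′) p same
  with ∷ʳ-injective (code σ) (code σ′) (trans (sym (code-∷ʳ σ y)) (trans same (code-∷ʳ σ′ y′)))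
... | same′ , same-rank with last-letter p (suc-injective same-rank)
... | refl = cong (_∷ʳ y) (code-injective rσ rσ′ prefix same′)
  where
    prefix : σ ↭ σ′
    prefix = drop-∷ (↭-trans (∷↭∷ʳ y σ) (↭-trans p (↭-sym (∷↭∷ʳ y σ′))))

-- Whether a word of distinct letters is a chain for z < x depends only on
-- the relative order of its letters, since its code does.
chain-bump⇔ : ∀ c π → Unique π → S.Chain (map (bump c) π) ⇔ S.Chain π
chain-bump⇔ c π u = begin
  S.Chain (map (bump c) π)              ≈⟨ chain⇔code-chain [] (map (bump c) π) (UP.map⁺ (bump-injective c) u) ⟩
  L.Chain (code (map (bump c) π))        ≡⟨ cong L.Chain (codeAfter-map (bump c) (bump-mono c) [] π) ⟩
  L.Chain (code π)                       ≈⟨ chain⇔code-chain [] π u ⟨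
  S.Chain π                              ∎
  where open ⇔-Reasoning

-- The code of c ∷ bump π is 1 followed by the code of bump π after c, so it
-- is a kernel position exactly when π is a chain for z < x.
kernel-code⇔chain : ∀ c π → Unique π → Kernel (code (extend (c , π))) ⇔ S.Chain π
kernel-code⇔chain c π u = begin
  Kernel (1 ∷ codeAfter (c ∷ []) (map (bump c) π))  ≈⟨ kernel⇔chain 1 _ ⟩
  L.Chain (codeAfter (c ∷ []) (map (bump c) π))     ≈⟨ chain⇔code-chain (c ∷ []) _ (UP.map⁺ (bump-injective c) u) ⟨
  S.Chain (map (bump c) π)                          ≈⟨ chain-bump⇔ c π u ⟩
  S.Chain π                                         ∎
  where open ⇔-Reasoning

unique-map⁺ : ∀ {A B : Set} (f : A → B) {xs} →
  (∀ {a b} → a ∈ xs → b ∈ xs → f a ≡ f b → a ≡ b) → Unique xs → Unique (map f xs)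
unique-map⁺ f inj [] = []
unique-map⁺ f inj (x∉ ∷ u) =
  AllP.map⁺ (All.tabulate (λ y∈ same → All.lookup x∉ y∈ (inj (here refl) (there y∈) same))) ∷
  unique-map⁺ f (λ a∈ b∈ → inj (there a∈) (there b∈)) u

length-cartesianProduct : ∀ {A B : Set} (xs : List A) (ys : List B) →
  length (cartesianProduct xs ys) ≡ length xs * length ys
length-cartesianProduct []       ys = refl
length-cartesianProduct (x ∷ xs) ys =
  trans (length-++ (map (x ,_) ys)) (cong₂ _+_ (length-map (x ,_) ys) (length-cartesianProduct xs ys))

blockPerms : ℕ → List (List ℕ)
blockPerms n = filter S.chain? (perms n)

∈-blockPerms⇔ : ∀ n → 1 ≤ n → ∀ π → (π ∈ blockPerms n) ⇔ (IsPerm n π × BlockCondition n π)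
∈-blockPerms⇔ n 1≤n π = mk⇔
  (λ π∈ → let π∈perms , c = ∈-filter⁻ S.chain? π∈ ; p = to (∈-perms⇔ n π) π∈perms
          in p , subst (λ k → BlockCondition k π) (length≡ p) (from (block⇔ p) c))
  (λ (p , block) → ∈-filter⁺ S.chain? (from (∈-perms⇔ n π) p)
                     (to (block⇔ p) (subst (λ k → BlockCondition k π) (sym (length≡ p)) block)))
  where
    open Equivalence
    length≡ : π ↭ oneTo n → length π ≡ n
    length≡ p = trans (↭-length p) (oneTo-length n)
    block⇔ : π ↭ oneTo n → BlockCondition (length π) π ⇔ S.Chain π
    block⇔ p = blockCondition⇔chain π (subst (1 ≤_) (sym (length≡ p)) 1≤n) (perm-unique p)

kernelWords : ℕ → List (List ℕ)
kernelWords n = map (code ∘ extend) (cartesianProduct (oneTo (suc n)) (blockPerms n))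

∈-kernelWords⇔ : ∀ n w → (w ∈ kernelWords n) ⇔ KernelPosition (suc n) w
∈-kernelWords⇔ n w = mk⇔ to from
  where
    to : w ∈ kernelWords n → KernelPosition (suc n) w
    to w∈ with ∈-map⁻ (code ∘ extend) w∈
    ... | (c , π) , cπ∈ , refl with ∈-cartesianProduct⁻ (oneTo (suc n)) (blockPerms n) cπ∈
    ...   | c∈ , π∈ with ∈-filter⁻ S.chain? π∈
    ...     | π∈perms , chain =
      trans (code-length [] (extend (c , π))) (trans (↭-length (extend-↭ c∈ p)) (oneTo-length (suc n))) ,
      code-position (extend (c , π)) ,
      Equivalence.from (kernel-code⇔chain c π (perm-unique p)) chain
      where p = Equivalence.to (∈-perms⇔ n π) π∈perms
    from : KernelPosition (suc n) w → w ∈ kernelWords n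
    from (rank , pos , k) with code-surjective (reverseView w) pos
    ... | τ , p , refl with ↭-extend (subst (λ m → τ ↭ oneTo m) rank p)
    ...   | c , π , c∈ , p′ , refl =
      ∈-map⁺ (code ∘ extend) (∈-cartesianProduct⁺ c∈
        (∈-filter⁺ S.chain? (Equivalence.from (∈-perms⇔ n π) p′)
          (Equivalence.to (kernel-code⇔chain c π (perm-unique p′)) k)))

kernelWords-unique : ∀ n → Unique (kernelWords n)
kernelWords-unique n = unique-map⁺ (code ∘ extend) injective
  (UP.cartesianProduct⁺ (oneTo-unique (suc n)) (UP.filter⁺ S.chain? (perms-unique n)))
  where
    permutation : ∀ {cπ} → cπ ∈ cartesianProduct (oneTo (suc n)) (blockPerms n) → extend cπ ↭ oneTo (suc n)
    permutation {c , π} cπ∈ with ∈-cartesianProduct⁻ (oneTo (suc n)) (blockPerms n) cπ∈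
    ... | c∈ , π∈ = extend-↭ c∈ (Equivalence.to (∈-perms⇔ n π) (proj₁ (∈-filter⁻ S.chain? π∈)))
    injective : ∀ {a b} → a ∈ _ → b ∈ _ → code (extend a) ≡ code (extend b) → a ≡ b
    injective a∈ b∈ same = extend-injective
      (code-injective (reverseView _) (reverseView _) (↭-trans (permutation a∈) (↭-sym (permutation b∈))) same)

length-kernelWords : ∀ n → length (kernelWords n) ≡ suc n * length (blockPerms n)
length-kernelWords n = begin
  length (kernelWords n)                                   ≡⟨ length-map (code ∘ extend) (cartesianProduct (oneTo (suc n)) (blockPerms n)) ⟩
  length (cartesianProduct (oneTo (suc n)) (blockPerms n)) ≡⟨ length-cartesianProduct (oneTo (suc n)) (blockPerms n) ⟩
  length (oneTo (suc n)) * length (blockPerms n)           ≡⟨ cong (_* length (blockPerms n)) (oneTo-length (suc n)) ⟩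
  suc n * length (blockPerms n)                            ∎
  where open ≡-Reasoning

corollary6p8 : ∀ n → 1 ≤ n →
    Σ ℕ λ K →
      HasCount (λ π → IsPerm n π × BlockCondition n π) K ×
      HasCount (KernelPosition (suc n)) (suc n * K)
corollary6p8 n 1≤n =
  length (blockPerms n) ,
  (blockPerms n , UP.filter⁺ S.chain? (perms-unique n) , ∈-blockPerms⇔ n 1≤n , refl) ,
  (kernelWords n , kernelWords-unique n , ∈-kernelWords⇔ n , length-kernelWords n)
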